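{- Let $\lambda\ge1$, $k\ge1$ and $1\le n_1\le\cdots\le n_k$ be integers, let $u$ be the largest index with $n_u=n_1$, set $N=\prod_{i=2}^k n_i$, and let $r=r_1\lambda N+r_2$ with integers $r_1\ge0$ and $r_2\in[\lambda N]$. If $cms_r(\lambda\mathcal{K}_{n_1,\ldots,n_k})=rn_1$, then $n_1^{u-1}\mid r_2$.
   Context: A hypergraph $\mathcal{H}=(V,E)$ consists of a finite vertex set and a finite set $E$ of edges, each with an associated vertex set; parallel edges are allowed. $\lambda\mathcal{H}$ replaces each edge by $\lambda$ distinct parallel edges. $[n]=\{0,\ldots,n-1\}$. An ordering of $\mathcal{H}$ is a bijection $\ell:E\to[\varepsilon]$, $\varepsilon=|E|$. For a sequence $S=e_0,\ldots,e_{s-1}$ of (not necessarily distinct) edges, $\mathcal{H}(S)$ is the hypergraph whose edges are the terms of $S$ counted with multiplicity. $S$ is cyclically consecutive in $\ell$ if $\ell(e_i)\equiv\ell(e_0)+i\pmod\varepsilon$ for all $i$ ($s$ may exceed $\varepsilon$). $cms_r(\ell)$ is the largest $s$ such that every sequence $S$ of $s$ cyclically consecutive edges of $\ell$ has maximum degree at most $r$; $cms_r(\mathcal{H})$ is its maximum over orderings. $\mathcal{K}_{n_1,\ldots,n_k}$ has vertex set a disjoint union of sets $N_1,\ldots,N_k$ with $|N_i|=n_i$ and exactly one edge for each $k$-set meeting every $N_i$ in exactly one vertex. -}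

module Defs where

open import Data.Nat using (ℕ; zero; suc; _+_; _*_; _≤_; _<_)
open import Data.Fin using (Fin; toℕ) renaming (zero to fzero; suc to fsuc; _≟_ to _≟ᶠ_)
open import Data.Product using (Σ; ∃; _×_; _,_; proj₁; proj₂)
open import Data.Sum using (_⊎_)
open import Data.Unit using (⊤; tt)
open import Data.Bool using (Bool; if_then_else_)
open import Relation.Nullary using (does)
open import Function.Bundles using (_⤖_; Bijection)
open import Relation.Binary.PropositionalEquality using (_≡_)

prod : ∀ {k} → (Fin k → ℕ) → ℕ
prod {zero}  f = 1
prod {suc k} f = f fzero * prod (λ i → f (fsuc i))

ModEq : ℕ → ℕ → ℕ → Set
ModEq m a b = (∃ λ q → a ≡ b + q * m) ⊎ (∃ λ q → b ≡ a + q * m)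

countBelow : (ℕ → Bool) → ℕ → ℕ
countBelow p zero    = 0
countBelow p (suc s) = countBelow p s + (if p s then 1 else 0)

-- Finite hypergraphs (parallel edges allowed: edges are elements of E,
-- each with its incidence to vertices).  ε is the number of edges |E|.

record Hypergraph : Set₁ where
  field
    V    : Set
    E    : Set
    _∈ₑ_ : V → E → Bool
    ε    : ℕ

module _ (H : Hypergraph) where
  open Hypergraph H

  Ordering : Set
  Ordering = E ⤖ Fin ε

  CycConsec : Ordering → ℕ → (ℕ → E) → Set
  CycConsec ℓ s e = ∀ i → i < s →
    ModEq ε (toℕ (Bijection.to ℓ (e i))) (toℕ (Bijection.to ℓ (e 0)) + i)

  -- degree of v in H(S), S = e_0..e_{s-1} counted with multiplicity
  degSeq : (ℕ → E) → ℕ → V → ℕ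
  degSeq e s v = countBelow (λ i → v ∈ₑ e i) s

  MaxDegLe : (ℕ → E) → ℕ → ℕ → Set
  MaxDegLe e s r = ∀ v → degSeq e s v ≤ r

  Good : ℕ → Ordering → ℕ → Set
  Good r ℓ s = ∀ e → CycConsec ℓ s e → MaxDegLe e s r

  IsCmsOrd : ℕ → Ordering → ℕ → Set
  IsCmsOrd r ℓ m = Good r ℓ m × (∀ s → Good r ℓ s → s ≤ m)

  IsCms : ℕ → ℕ → Set
  IsCms r m = (∃ λ ℓ → IsCmsOrd r ℓ m) × (∀ ℓ m' → IsCmsOrd r ℓ m' → m' ≤ m)

Tuple : (k : ℕ) → (Fin k → ℕ) → Set
Tuple zero    n = ⊤
Tuple (suc k) n = Fin (n fzero) × Tuple k (λ i → n (fsuc i))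

lookupT : ∀ {k} {n : Fin k → ℕ} → Tuple k n → (j : Fin k) → Fin (n j)
lookupT {suc k} (x , t) fzero    = x
lookupT {suc k} (x , t) (fsuc j) = lookupT t j

-- vertices: disjoint union of N_j = Fin (n j); edges: one per transversal
-- k-set (a tuple), times lam parallel copies
lamK : (lam k : ℕ) → (Fin k → ℕ) → Hypergraph
lamK lam k n = record
  { V    = Σ (Fin k) (λ j → Fin (n j))
  ; E    = Tuple k n × Fin lam
  ; _∈ₑ_ = λ v e → does (lookupT (proj₁ e) (proj₁ v) ≟ᶠ proj₂ v)
  ; ε    = lam * prod n
  }

-- N = n_2 ⋯ n_k (1-based), i.e. product of all but the first part size
tailProd : ∀ {k} → (Fin (suc k) → ℕ) → ℕ
tailProd n = prod (λ i → n (fsuc i))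

-- Let m = n₁ and T = r·m. A window of T cyclically consecutive edges meets each of the m
-- vertices of a part of size m at most r times, hence exactly r times as the counts sum to T;
-- comparing the windows starting at p and p + 1 then shows that the edges at positions p and
-- p + T agree in that part. So along an ordering attaining cms_r = T the coordinates in the
-- first u parts are T-periodic as well as ε-periodic. Let C be the number of positions among
-- the first T whose edge has coordinate 0 in each of these parts, and λS the number among the
-- first ε, where n₁^u · S = ∏ nᵢ. Counting such positions among the first ε·T in two ways
-- gives T · λS = ε · C = λ n₁^u S · C, so n₁^u ∣ T = r n₁; and n₁^(u-1) also divides N.
module Submission where

open import Defs
open import Data.Nat using (ℕ; zero; suc; _+_; _*_; _^_; _≤_; _<_)
open import Data.Nat.Divisibility using (_∣_)
open import Data.Fin using (Fin; toℕ) renaming (zero to fzero; _≤_ to _≤ᶠ_)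
open import Relation.Binary.PropositionalEquality using (_≡_)

open import Data.Nat using (z≤n; s≤s; NonZero; >-nonZero; _%_; _/_)
open import Data.Nat.Properties
open import Data.Nat.DivMod using (m%n<n; m≡m%n+[m/n]*n; %-distribˡ-+; m%n%n≡m%n; [m+n]%n≡m%n; m<n⇒m%n≡m)
open import Data.Nat.Divisibility using (divides; 1∣_; ∣-refl; *-monoʳ-∣; *-cancelˡ-∣; ∣n⇒∣m*n; ∣m+n∣m⇒∣n)
open import Data.Nat.Tactic.RingSolver using (solve-∀)
open import Data.Fin using (fromℕ<; combine; _↑ˡ_; _↑ʳ_) renaming (suc to fsuc; _≟_ to _≟ᶠ_)
open import Data.Fin.Properties using (1↔⊤; *↔×; remQuot-combine; toℕ-fromℕ<; fromℕ<-cong; toℕ-injective; toℕ<n; toℕ≤pred[n])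
open import Data.Fin.Permutation using (Permutation)
open import Data.Bool using (Bool; true; false; if_then_else_; _∧_)
open import Data.Product using (_×_; _,_; proj₁; proj₂)
open import Data.Product.Algebra using (×-comm)
open import Data.Product.Function.NonDependent.Propositional using (_×-↔_)
open import Data.Sum using (inj₂)
open import Function using (_∘_)
open import Function.Bundles using (_↔_; Inverse; Bijection)
open import Function.Properties.Bijection using (⤖⇒↔)
open import Function.Properties.Inverse using (↔-refl; ↔-trans; ↔-sym)
open import Relation.Nullary using (Dec; does; yes; no)
open import Relation.Nullary.Decidable using (dec-true)
open import Relation.Binary.PropositionalEquality using (refl; sym; trans; cong; cong₂; subst; _≗_; module ≡-Reasoning)
open import Algebra.Properties.CommutativeMonoid.Sum +-0-commutativeMonoid using (sum; sum-cong-≗; ∑-distrib-+; sum-permute)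
open import Algebra.Properties.CommutativeSemigroup *-commutativeSemigroup using (xy∙z≈xz∙y)

Periodic : {A : Set} → (ℕ → A) → ℕ → Set
Periodic a t = ∀ p → a (p + t) ≡ a p

indicator : Bool → ℕ
indicator b = if b then 1 else 0

indicator-does≡1 : ∀ {P : Set} (d : Dec P) → indicator (does d) ≡ 1 → P
indicator-does≡1 (yes p) _  = p
indicator-does≡1 (no _)  ()

countBelow-cong : ∀ {g h : ℕ → Bool} → g ≗ h → countBelow g ≗ countBelow h
countBelow-cong g≗h zero    = refl
countBelow-cong g≗h (suc s) = cong₂ _+_ (countBelow-cong g≗h s) (cong indicator (g≗h s))

countBelow-+ : ∀ g a b → countBelow g (a + b) ≡ countBelow g a + countBelow (g ∘ (a +_)) b
countBelow-+ g a zero    = trans (cong (countBelow g) (+-identityʳ a)) (sym (+-identityʳ _))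
countBelow-+ g a (suc b) rewrite +-suc a b | countBelow-+ g a b =
  +-assoc (countBelow g a) (countBelow (g ∘ (a +_)) b) _

countBelow-periodic : ∀ {g t} → Periodic g t → ∀ a → countBelow g (a * t) ≡ a * countBelow g t
countBelow-periodic per zero = refl
countBelow-periodic {g} {t} per (suc a) = begin
  countBelow g (t + a * t)                          ≡⟨ countBelow-+ g t (a * t) ⟩
  countBelow g t + countBelow (g ∘ (t +_)) (a * t)  ≡⟨ cong (countBelow g t +_) (countBelow-cong shift (a * t)) ⟩
  countBelow g t + countBelow g (a * t)             ≡⟨ cong (countBelow g t +_) (countBelow-periodic per a) ⟩
  countBelow g t + a * countBelow g t               ∎
  where
  open ≡-Reasoning
  shift : g ∘ (t +_) ≗ g
  shift i = trans (cong g (+-comm t i)) (per i)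

countBelow-two-periods : ∀ {g s t} → Periodic g s → Periodic g t →
  t * countBelow g s ≡ s * countBelow g t
countBelow-two-periods {g} {s} {t} s-per t-per = begin
  t * countBelow g s   ≡⟨ countBelow-periodic s-per t ⟨
  countBelow g (t * s) ≡⟨ cong (countBelow g) (*-comm t s) ⟩
  countBelow g (s * t) ≡⟨ countBelow-periodic t-per s ⟩
  s * countBelow g t   ∎
  where open ≡-Reasoning

countBelow≡sum : ∀ g m → countBelow g m ≡ sum {m} (indicator ∘ g ∘ toℕ)
countBelow≡sum g zero    = refl
countBelow≡sum g (suc m) =
  trans (countBelow-+ g 1 m) (cong (indicator (g 0) +_) (countBelow≡sum (g ∘ suc) m))

sum-const : ∀ m c → sum {m} (λ _ → c) ≡ m * c
sum-const zero    c = refl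
sum-const (suc m) c = cong (c +_) (sum-const m c)

sum-zero : ∀ m → sum {m} (λ _ → 0) ≡ 0
sum-zero m = trans (sum-const m 0) (*-zeroʳ m)

sum-↑ : ∀ p q (h : Fin (p + q) → ℕ) → sum h ≡ sum {p} (h ∘ (_↑ˡ q)) + sum {q} (h ∘ (p ↑ʳ_))
sum-↑ zero    q h = refl
sum-↑ (suc p) q h = trans (cong (h fzero +_) (sum-↑ p q (h ∘ fsuc))) (sym (+-assoc (h fzero) _ _))

sum-combine : ∀ a b (f : Fin (a * b) → ℕ) → sum f ≡ sum {a} (λ i → sum {b} (λ j → f (combine i j)))
sum-combine zero    b f = refl
sum-combine (suc a) b f =
  trans (sum-↑ b (a * b) f) (cong (sum {b} (f ∘ combine {suc a} fzero) +_) (sum-combine a b (f ∘ (b ↑ʳ_))))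

sum-reindex : ∀ {A : Set} {m} (ι κ : Fin m ↔ A) (f : A → ℕ) →
  sum (f ∘ Inverse.to ι) ≡ sum (f ∘ Inverse.to κ)
sum-reindex {m = m} ι κ f =
  trans (sum-permute (f ∘ Inverse.to ι) π) (sum-cong-≗ (cong f ∘ Inverse.strictlyInverseˡ ι ∘ Inverse.to κ))
  where
  π : Permutation m m
  π = ↔-trans κ (↔-sym ι)

sum-≤ : ∀ {m r} (d : Fin m → ℕ) → (∀ x → d x ≤ r) → sum d ≤ m * r
sum-≤ {zero}  d d≤r = z≤n
sum-≤ {suc m} d d≤r = +-mono-≤ (d≤r fzero) (sum-≤ (d ∘ fsuc) (d≤r ∘ fsuc))

+-tight : ∀ {a b c d} → a ≤ c → b ≤ d → a + b ≡ c + d → a ≡ c × b ≡ d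
+-tight {a} {b} {c} {d} a≤c b≤d eq = a≡c , +-cancelˡ-≡ c b d (trans (cong (_+ b) (sym a≡c)) eq)
  where
  a≡c : a ≡ c
  a≡c = ≤-antisym a≤c (+-cancelʳ-≤ d c a (≤-trans (≤-reflexive (sym eq)) (+-monoʳ-≤ a b≤d)))

sum-tight : ∀ {m r} (d : Fin m → ℕ) → (∀ x → d x ≤ r) → sum d ≡ m * r → ∀ x → d x ≡ r
sum-tight {suc m} d d≤r eq fzero    = proj₁ (+-tight (d≤r fzero) (sum-≤ (d ∘ fsuc) (d≤r ∘ fsuc)) eq)
sum-tight {suc m} d d≤r eq (fsuc x) =
  sum-tight (d ∘ fsuc) (d≤r ∘ fsuc) (proj₂ (+-tight (d≤r fzero) (sum-≤ (d ∘ fsuc) (d≤r ∘ fsuc)) eq)) x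

occurrences : ∀ {m} → (ℕ → Fin m) → Fin m → ℕ → ℕ
occurrences a x = countBelow (λ i → does (a i ≟ᶠ x))

sum-indicator-≟ : ∀ {m} (y : Fin m) → sum (λ x → indicator (does (y ≟ᶠ x))) ≡ 1
sum-indicator-≟ {suc m} fzero    = cong suc (sum-zero m)
sum-indicator-≟ {suc m} (fsuc y) = sum-indicator-≟ y

sum-occurrences : ∀ {m} (a : ℕ → Fin m) s → sum (λ x → occurrences a x s) ≡ s
sum-occurrences {m} a zero = sum-zero m
sum-occurrences a (suc s) = begin
  sum (λ x → occurrences a x s + indicator (does (a s ≟ᶠ x)))
    ≡⟨ ∑-distrib-+ (λ x → occurrences a x s) (λ x → indicator (does (a s ≟ᶠ x))) ⟩
  sum (λ x → occurrences a x s) + sum (λ x → indicator (does (a s ≟ᶠ x)))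
    ≡⟨ cong₂ _+_ (sum-occurrences a s) (sum-indicator-≟ (a s)) ⟩
  s + 1
    ≡⟨ +-comm s 1 ⟩
  suc s ∎
  where open ≡-Reasoning

tight-window-periodic : ∀ {m r T} (a : ℕ → Fin m) → m * r ≡ T →
  (∀ p x → occurrences (a ∘ (p +_)) x T ≤ r) → Periodic a T
tight-window-periodic {m} {r} {T} a m*r≡T window≤r p =
  indicator-does≡1 (a (p + T) ≟ᶠ a p) (+-cancelˡ-≡ r _ 1 (trans (sym from-start) (trans from-end (+-comm 1 r))))
  where
  tight : ∀ q x → occurrences (a ∘ (q +_)) x T ≡ r
  tight q = sum-tight _ (window≤r q) (trans (sum-occurrences (a ∘ (q +_)) T) (sym m*r≡T))
  hit : ℕ → Bool
  hit i = does (a (p + i) ≟ᶠ a p)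
  from-start : countBelow hit (suc T) ≡ r + indicator (hit T)
  from-start = cong (_+ indicator (hit T)) (tight p (a p))
  from-end : countBelow hit (suc T) ≡ 1 + r
  from-end = trans (countBelow-+ hit 1 T) (cong₂ _+_
    (cong indicator (dec-true (a (p + 0) ≟ᶠ a p) (cong a (+-identityʳ p))))
    (trans (countBelow-cong (λ i → cong (λ q → does (a q ≟ᶠ a p)) (+-suc p i)) T) (tight (suc p) (a p))))

prod-nonZero : ∀ {k} (f : Fin k → ℕ) → (∀ i → NonZero (f i)) → NonZero (prod f)
prod-nonZero {zero}  f nz = _
prod-nonZero {suc k} f nz =
  m*n≢0 (f fzero) (prod (f ∘ fsuc)) {{nz fzero}} {{prod-nonZero (f ∘ fsuc) (nz ∘ fsuc)}}

tupleIndex : ∀ {k} (n : Fin k → ℕ) → Fin (prod n) ↔ Tuple k n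
tupleIndex {zero}  n = 1↔⊤
tupleIndex {suc k} n = ↔-trans *↔× (↔-refl ×-↔ tupleIndex (n ∘ fsuc))

edgeIndex : ∀ lam {k} (n : Fin k → ℕ) → Fin (lam * prod n) ↔ (Tuple k n × Fin lam)
edgeIndex lam n = ↔-trans *↔× (↔-trans (↔-refl ×-↔ tupleIndex n) (×-comm _ _))

countTuples : ∀ {k} (n : Fin k → ℕ) → (Tuple k n → Bool) → ℕ
countTuples n P = sum (indicator ∘ P ∘ Inverse.to (tupleIndex n))

countTuples-suc : ∀ {k} (n : Fin (suc k) → ℕ) (P : Tuple (suc k) n → Bool) →
  countTuples n P ≡ sum {n fzero} (λ x → countTuples (n ∘ fsuc) (λ t → P (x , t)))
countTuples-suc n P = trans (sum-combine (n fzero) (prod (n ∘ fsuc)) _)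
  (sum-cong-≗ λ x → sum-cong-≗ λ j →
    cong (λ q → indicator (P (proj₁ q , Inverse.to (tupleIndex (n ∘ fsuc)) (proj₂ q)))) (remQuot-combine x j))

sum-edges : ∀ lam {k} (n : Fin k → ℕ) (ι : Fin (lam * prod n) ↔ (Tuple k n × Fin lam)) (P : Tuple k n → Bool) →
  sum (indicator ∘ P ∘ proj₁ ∘ Inverse.to ι) ≡ lam * countTuples n P
sum-edges lam n ι P = begin
  sum (indicator ∘ P ∘ proj₁ ∘ Inverse.to ι)
    ≡⟨ sum-reindex ι (edgeIndex lam n) (indicator ∘ P ∘ proj₁) ⟩
  sum (indicator ∘ P ∘ proj₁ ∘ Inverse.to (edgeIndex lam n))
    ≡⟨ sum-combine lam (prod n) _ ⟩
  sum {lam} (λ i → sum (λ j → indicator (P (proj₁ (Inverse.to (edgeIndex lam n) (combine {lam} {prod n} i j))))))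
    ≡⟨ sum-cong-≗ {lam} (λ i → sum-cong-≗ {prod n} λ j →
         cong (λ q → indicator (P (Inverse.to (tupleIndex n) (proj₂ q)))) (remQuot-combine i j)) ⟩
  sum {lam} (λ _ → countTuples n P)
    ≡⟨ sum-const lam _ ⟩
  lam * countTuples n P ∎
  where open ≡-Reasoning

isZero : ∀ {m} → Fin m → Bool
isZero fzero    = true
isZero (fsuc _) = false

-- For c beyond the arity only the k existing coordinates are constrained.
zeroPrefix : ∀ {k} (n : Fin k → ℕ) → ℕ → Tuple k n → Bool
zeroPrefix         n zero    t       = true
zeroPrefix {zero}  n (suc c) t       = true
zeroPrefix {suc k} n (suc c) (x , t) = isZero x ∧ zeroPrefix (n ∘ fsuc) c t

zeroPrefix-cong : ∀ {k} (n : Fin k → ℕ) c (t t' : Tuple k n) →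
  (∀ j → toℕ j < c → lookupT t j ≡ lookupT t' j) → zeroPrefix n c t ≡ zeroPrefix n c t'
zeroPrefix-cong         n zero    t       t'        eq = refl
zeroPrefix-cong {zero}  n (suc c) t       t'        eq = refl
zeroPrefix-cong {suc k} n (suc c) (x , t) (x' , t') eq =
  cong₂ (λ y b → isZero y ∧ b) (eq fzero (s≤s z≤n)) (zeroPrefix-cong (n ∘ fsuc) c t t' (λ j j<c → eq (fsuc j) (s≤s j<c)))

prefixProd : ∀ {k} → ℕ → (Fin k → ℕ) → ℕ
prefixProd zero            f = 1
prefixProd {zero}  (suc c) f = 1
prefixProd {suc k} (suc c) f = f fzero * prefixProd c (f ∘ fsuc)

prefixProd∣prod : ∀ {k} c (f : Fin k → ℕ) → prefixProd c f ∣ prod f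
prefixProd∣prod zero            f = 1∣ prod f
prefixProd∣prod {zero}  (suc c) f = ∣-refl
prefixProd∣prod {suc k} (suc c) f = *-monoʳ-∣ (f fzero) (prefixProd∣prod c (f ∘ fsuc))

prefixProd-pow : ∀ {k} c (f : Fin k → ℕ) {a} → c ≤ k → (∀ j → toℕ j < c → f j ≡ a) → prefixProd c f ≡ a ^ c
prefixProd-pow zero            f c≤k eq = refl
prefixProd-pow {suc k} (suc c) f (s≤s c≤k) eq =
  cong₂ _*_ (eq fzero (s≤s z≤n)) (prefixProd-pow c (f ∘ fsuc) c≤k (λ j j<c → eq (fsuc j) (s≤s j<c)))

*-sum-atZero : ∀ m (f : Fin m → ℕ) a → (∀ x → f x ≡ (if isZero x then a else 0)) → m * sum f ≡ m * a
*-sum-atZero zero    f a eq = refl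
*-sum-atZero (suc m) f a eq =
  cong (suc m *_) (trans (sum-cong-≗ eq) (trans (cong (a +_) (sum-zero m)) (+-identityʳ a)))

countTuples-isZero-∧ : ∀ {k} (n : Fin k → ℕ) (P : Tuple k n → Bool) {m} (x : Fin m) →
  countTuples n (λ t → isZero x ∧ P t) ≡ (if isZero x then countTuples n P else 0)
countTuples-isZero-∧ n P fzero    = refl
countTuples-isZero-∧ n P (fsuc x) = sum-zero (prod n)

prefixProd*countZeroPrefix : ∀ {k} c (n : Fin k → ℕ) → prefixProd c n * countTuples n (zeroPrefix n c) ≡ prod n
prefixProd*countZeroPrefix zero n =
  trans (+-identityʳ _) (trans (sum-const (prod n) 1) (*-identityʳ (prod n)))
prefixProd*countZeroPrefix {zero}  (suc c) n = refl
prefixProd*countZeroPrefix {suc k} (suc c) n = begin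
  n₀ * M * countTuples n (zeroPrefix n (suc c))
    ≡⟨ cong (n₀ * M *_) (countTuples-suc n (zeroPrefix n (suc c))) ⟩
  n₀ * M * X
    ≡⟨ xy∙z≈xz∙y n₀ M X ⟩
  n₀ * X * M
    ≡⟨ cong (_* M) (*-sum-atZero n₀ _ S (countTuples-isZero-∧ (n ∘ fsuc) (zeroPrefix (n ∘ fsuc) c))) ⟩
  n₀ * S * M
    ≡⟨ *-assoc n₀ S M ⟩
  n₀ * (S * M)
    ≡⟨ cong (n₀ *_) (trans (*-comm S M) (prefixProd*countZeroPrefix c (n ∘ fsuc))) ⟩
  n₀ * prod (n ∘ fsuc) ∎
  where
  open ≡-Reasoning
  n₀ = n fzero
  M = prefixProd c (n ∘ fsuc)
  S = countTuples (n ∘ fsuc) (zeroPrefix (n ∘ fsuc) c)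
  X = sum {n₀} (λ x → countTuples (n ∘ fsuc) (λ t → isZero x ∧ zeroPrefix (n ∘ fsuc) c t))

module Positions (H : Hypergraph) (ℓ : Ordering H) .{{_ : NonZero (Hypergraph.ε H)}} where
  open Hypergraph H

  index : Fin ε ↔ E
  index = ↔-sym (⤖⇒↔ ℓ)

  edgeAt : ℕ → E
  edgeAt p = Inverse.to index (fromℕ< (m%n<n p ε))

  edgeAt-periodic : Periodic edgeAt ε
  edgeAt-periodic p = cong (Inverse.to index) (fromℕ<-cong _ _ ([m+n]%n≡m%n p ε) (m%n<n (p + ε) ε) (m%n<n p ε))

  edgeAt-toℕ : ∀ (i : Fin ε) → edgeAt (toℕ i) ≡ Inverse.to index i
  edgeAt-toℕ i = cong (Inverse.to index) (toℕ-injective (trans (toℕ-fromℕ< (m%n<n (toℕ i) ε)) (m<n⇒m%n≡m (toℕ<n i))))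

  position-edgeAt : ∀ p → toℕ (Bijection.to ℓ (edgeAt p)) ≡ p % ε
  position-edgeAt p = trans (cong toℕ (Inverse.strictlyInverseʳ index _)) (toℕ-fromℕ< (m%n<n p ε))

  edgeAt-consecutive : ∀ p s → CycConsec H ℓ s (edgeAt ∘ (p +_))
  edgeAt-consecutive p s i _ rewrite position-edgeAt (p + i) | position-edgeAt (p + 0) | +-identityʳ p =
    inj₂ (x / ε , trans (m≡m%n+[m/n]*n x ε) (cong (_+ x / ε * ε) x%ε≡[p+i]%ε))
    where
    x = p % ε + i
    x%ε≡[p+i]%ε : x % ε ≡ (p + i) % ε
    x%ε≡[p+i]%ε = trans (%-distribˡ-+ (p % ε) i ε)
      (trans (cong (λ z → (z + i % ε) % ε) (m%n%n≡m%n p ε)) (sym (%-distribˡ-+ p i ε)))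

*-rearrange : ∀ a m s c → a * (m * s) * c ≡ m * c * (a * s)
*-rearrange = solve-∀

prefixProd∣window : ∀ lam {k} (n : Fin k → ℕ) {{_ : NonZero (lam * prod n)}} (ℓ : Ordering (lamK lam k n)) {r T} c →
  Good (lamK lam k n) r ℓ T → (∀ j → toℕ j < c → n j * r ≡ T) → prefixProd c n ∣ T
prefixProd∣window lam n ℓ {r} {T} c good tight = divides C (trans T≡M*C (*-comm M C))
  where
  open Positions (lamK lam _ n) ℓ
  coordinate-periodic : ∀ j → toℕ j < c → Periodic (λ p → lookupT (proj₁ (edgeAt p)) j) T
  coordinate-periodic j j<c = tight-window-periodic _ (tight j j<c)
    (λ p x → good (edgeAt ∘ (p +_)) (edgeAt-consecutive p T) (j , x))
  atZero : ℕ → Bool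
  atZero p = zeroPrefix n c (proj₁ (edgeAt p))
  M = prefixProd c n
  S = countTuples n (zeroPrefix n c)
  C = countBelow atZero T
  atZero-per-period : countBelow atZero (lam * prod n) ≡ lam * S
  atZero-per-period = trans (countBelow≡sum atZero (lam * prod n))
    (trans (sum-cong-≗ {lam * prod n} (cong (indicator ∘ zeroPrefix n c ∘ proj₁) ∘ edgeAt-toℕ)) (sum-edges lam n index (zeroPrefix n c)))
  counted-twice : T * (lam * S) ≡ lam * prod n * C
  counted-twice = trans (cong (T *_) (sym atZero-per-period)) (countBelow-two-periods
    (λ p → cong (zeroPrefix n c ∘ proj₁) (edgeAt-periodic p))
    (λ p → zeroPrefix-cong n c _ _ (λ j j<c → coordinate-periodic j j<c p)))
  instance
    nonZero-lamS : NonZero (lam * S)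
    nonZero-lamS = m*n≢0 lam S {{m*n≢0⇒m≢0 lam}}
      {{m*n≢0⇒n≢0 M {{subst NonZero (sym (prefixProd*countZeroPrefix c n)) (m*n≢0⇒n≢0 lam)}}}}
  T≡M*C : T ≡ M * C
  T≡M*C = *-cancelʳ-≡ T (M * C) (lam * S) (trans counted-twice
    (trans (cong (λ z → lam * z * C) (sym (prefixProd*countZeroPrefix c n))) (*-rearrange lam M S C)))

lemma3p3 : (lam k : ℕ) → 1 ≤ lam → (n : Fin (suc k) → ℕ) → 1 ≤ n fzero →
    (∀ i j → i ≤ᶠ j → n i ≤ n j) →
    (u : Fin (suc k)) → n u ≡ n fzero → (∀ j → n j ≡ n fzero → j ≤ᶠ u) →
    (r₁ r₂ : ℕ) → r₂ < lam * tailProd n →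
    IsCms (lamK lam (suc k) n) (r₁ * (lam * tailProd n) + r₂)
      ((r₁ * (lam * tailProd n) + r₂) * n fzero) →
    n fzero ^ toℕ u ∣ r₂
lemma3p3 lam k 1≤lam n 1≤n₀ mono u nᵤ≡n₀ _ r₁ r₂ _ ((ℓ , good , _) , _) =
  ∣m+n∣m⇒∣n n₀^u∣r (∣n⇒∣m*n r₁ (∣n⇒∣m*n lam n₀^u∣N))
  where
  n₀ = n fzero
  r = r₁ * (lam * tailProd n) + r₂
  initial : ∀ j → toℕ j < suc (toℕ u) → n j ≡ n₀
  initial j (s≤s j≤u) = ≤-antisym (≤-trans (mono j u j≤u) (≤-reflexive nᵤ≡n₀)) (mono fzero j z≤n)
  instance
    nonZero-n₀ : NonZero n₀
    nonZero-n₀ = >-nonZero 1≤n₀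
    nonZero-ε : NonZero (lam * prod n)
    nonZero-ε = m*n≢0 lam (prod n) {{>-nonZero 1≤lam}}
      {{prod-nonZero n (λ i → >-nonZero (≤-trans 1≤n₀ (mono fzero i z≤n)))}}
  n₀^[1+u]∣r*n₀ : n₀ ^ suc (toℕ u) ∣ r * n₀
  n₀^[1+u]∣r*n₀ = subst (_∣ r * n₀) (prefixProd-pow (suc (toℕ u)) n (s≤s (toℕ≤pred[n] u)) initial)
    (prefixProd∣window lam n ℓ (suc (toℕ u)) good (λ j j<c → trans (cong (_* r) (initial j j<c)) (*-comm n₀ r)))
  n₀^u∣r : n₀ ^ toℕ u ∣ r
  n₀^u∣r = *-cancelˡ-∣ n₀ (subst (n₀ ^ suc (toℕ u) ∣_) (*-comm r n₀) n₀^[1+u]∣r*n₀)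
  n₀^u∣N : n₀ ^ toℕ u ∣ tailProd n
  n₀^u∣N = subst (_∣ tailProd n) (prefixProd-pow (toℕ u) (n ∘ fsuc) (toℕ≤pred[n] u) (λ j j<u → initial (fsuc j) (s≤s j<u)))
    (prefixProd∣prod (toℕ u) (n ∘ fsuc))
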